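{- Let $V$ be a finite-dimensional vector space over $\mathbb{F}_q$, let $W$ be a subspace of $V$ and let $T\in L(W,V)$. Then the defect dimensions of $T$ satisfy $\lambda_j(T)\geq \lambda_{j+1}(T)$ for all $1\leq j\leq \ell(T)-1$.
   Context: $\mathbb{F}_q$ is the finite field with $q$ elements ($q$ a prime power). For a subspace $W$ of $V$, $L(W,V)$ denotes the space of $\mathbb{F}_q$-linear maps $W\to V$. For $T\in L(W,V)$ define subspaces $W_0=V$, $W_1=W$ and $W_{i+1}=\{v\in W_i: Tv\in W_i\}$ for $i\geq 1$; put $d_i=\dim W_i$ and $\ell(T)=\min\{i\geq 0: W_i=W_{i+1}\}$. The defect dimensions of $T$ are $\lambda_j(T)=d_{j-1}-d_j$ for $1\leq j\leq \ell(T)$. -}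

module Defs where

open import Level using (Level; _⊔_) renaming (suc to lsuc)
open import Algebra.Bundles using (CommutativeRing)
open import Data.Nat using (ℕ; zero; suc; _<_)
open import Data.Fin using (Fin; zero; suc)
open import Data.Product using (Σ; ∃; _×_)
open import Data.Unit.Polymorphic using (⊤)
open import Function using (_∘_)
open import Relation.Nullary using (¬_)
open import Relation.Binary using (Decidable)
open import Relation.Binary.PropositionalEquality using (_≡_)

record FiniteField (c ℓ : Level) : Set (lsuc (c ⊔ ℓ)) where
  field
    commRing  : CommutativeRing c ℓ
  open CommutativeRing commRing public
  field
    0≉1       : ¬ (0# ≈ 1#)
    inverse   : ∀ x → ¬ (x ≈ 0#) → Σ Carrier (λ y → x * y ≈ 1#)
    _≟_       : Decidable _≈_
    q         : ℕ
    enum      : Fin q → Carrier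
    enum-inj  : ∀ i j → enum i ≈ enum j → i ≡ j
    enum-surj : ∀ x → Σ (Fin q) (λ i → enum i ≈ x)

module _ {c ℓ : Level} (F : FiniteField c ℓ) (n : ℕ) where
  open FiniteField F using (Carrier; _≈_; _+_; _*_; 0#)

  Vec : Set c
  Vec = Fin n → Carrier

  _≈ᵥ_ : Vec → Vec → Set ℓ
  u ≈ᵥ v = ∀ i → u i ≈ v i

  _+ᵥ_ : Vec → Vec → Vec
  (u +ᵥ v) i = u i + v i

  _·ᵥ_ : Carrier → Vec → Vec
  (a ·ᵥ v) i = a * v i

  0ᵥ : Vec
  0ᵥ i = 0#

  lincomb : (k : ℕ) → (Fin k → Carrier) → (Fin k → Vec) → Vec
  lincomb zero    cs bs = 0ᵥ
  lincomb (suc k) cs bs = (cs zero ·ᵥ bs zero) +ᵥ lincomb k (cs ∘ suc) (bs ∘ suc)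

  LinIndep : (k : ℕ) → (Fin k → Vec) → Set (c ⊔ ℓ)
  LinIndep k bs = ∀ (cs : Fin k → Carrier) → lincomb k cs bs ≈ᵥ 0ᵥ → ∀ i → cs i ≈ 0#

  HasDim : {p : Level} → (Vec → Set p) → ℕ → Set (c ⊔ ℓ ⊔ p)
  HasDim P k = Σ (Fin k → Vec) λ bs →
                 (∀ i → P (bs i)) × LinIndep k bs ×
                 (∀ v → P v → Σ (Fin k → Carrier) λ cs → v ≈ᵥ lincomb k cs bs)

  SameSet : {p : Level} → (Vec → Set p) → (Vec → Set p) → Set (c ⊔ p)
  SameSet P Q = (∀ v → P v → Q v) × (∀ v → Q v → P v)

  record Subspace (p : Level) : Set (c ⊔ ℓ ⊔ lsuc p) where
    field
      pred   : Vec → Set p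
      resp   : ∀ {u v} → u ≈ᵥ v → pred u → pred v
      0∈     : pred 0ᵥ
      +∈     : ∀ {u v} → pred u → pred v → pred (u +ᵥ v)
      ·∈     : ∀ a {v} → pred v → pred (a ·ᵥ v)

  -- T ∈ L(W,V): represented by a function on V, only its values on W matter
  record LinMap {p : Level} (W : Subspace p) : Set (c ⊔ ℓ ⊔ p) where
    open Subspace W
    field
      fun   : Vec → Vec
      cong  : ∀ {u v} → pred u → pred v → u ≈ᵥ v → fun u ≈ᵥ fun v
      add   : ∀ {u v} → pred u → pred v → fun (u +ᵥ v) ≈ᵥ (fun u +ᵥ fun v)
      hom   : ∀ a {v} → pred v → fun (a ·ᵥ v) ≈ᵥ (a ·ᵥ fun v)

  module _ {p : Level} (W : Subspace p) (T : LinMap W) where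
    Wseq : ℕ → Vec → Set p
    Wseq zero          v = ⊤
    Wseq (suc zero)    v = Subspace.pred W v
    Wseq (suc (suc i)) v = Wseq (suc i) v × Wseq (suc i) (LinMap.fun T v)

    IsLength : ℕ → Set (c ⊔ p)
    IsLength L = SameSet (Wseq L) (Wseq (suc L))
                 × (∀ i → i < L → ¬ SameSet (Wseq i) (Wseq (suc i)))

module Submission where

-- For v ∈ W_{j+1} we have T v ∈ W_j, so (x , y) ↦ T x + y maps W_{j+1} × W_{j+1} into W_j,
-- and its kernel {(x , − T x) : x ∈ W_{j+2}} is a copy of W_{j+2}.  Rank–nullity gives
-- 2 d_{j+1} ≤ d_{j+2} + d_j, which rearranges to the claim.  Rank–nullity itself is proved
-- in coordinates: if m vectors lie in the span of b vectors and their linear relations are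
-- spanned by k coefficient vectors, then m ≤ k + b, by Gaussian elimination.

open import Defs
open import Level using (Level; _⊔_)
open import Data.Nat using (ℕ; zero; suc; _+_; _∸_; _≤_; z≤n; s≤s)
import Data.Nat.Properties as ℕ
open import Data.Fin using (Fin; zero; suc; punchIn; _↑ˡ_; _↑ʳ_; splitAt; join)
import Data.Fin.Properties as Fin
open import Data.Sum using ([_,_])
open import Data.Sum.Properties using ([,]-map)
open import Data.Product using (Σ; _×_; _,_; proj₁; proj₂)
open import Data.Vec.Functional using (_++_; insertAt)
open import Data.Vec.Functional.Properties using (insertAt-lookup; insertAt-punchIn; lookup-++ˡ; lookup-++ʳ)
open import Data.Vec.Functional.Relation.Unary.All.Properties using (++⁺)
open import Data.Empty using (⊥-elim)
open import Function using (_∘_; id)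
open import Relation.Nullary using (¬_; yes; no; ¬?)
open import Relation.Nullary.Decidable using (decidable-stable)
open import Relation.Binary.PropositionalEquality as ≡ using (_≡_)

++-suc : ∀ {a} {A : Set a} {m n} (u : Fin (suc m) → A) (v : Fin n → A) r →
         (u ++ v) (suc r) ≡ ((u ∘ suc) ++ v) r
++-suc {m = m} u v r = [,]-map {f = suc} {g = id} {f′ = u} {g′ = v} (splitAt m r)

↑-split : ∀ {p} a {b} (P : Fin (a + b) → Set p) →
          (∀ l → P (l ↑ˡ b)) → (∀ r → P (a ↑ʳ r)) → ∀ z → P z
↑-split a {b} P left right z =
  ≡.subst P (Fin.join-splitAt a b z) ([_,_] {C = P ∘ join a b} left right (splitAt a z))

module LinearCombination {c ℓ : Level} (F : FiniteField c ℓ) where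
  open FiniteField F hiding (zero) renaming (_+_ to _⊕_)
  open import Algebra.Properties.Semiring.Sum semiring
  open import Algebra.Properties.Ring ring using (-1*x≈-x; x∙y⁻¹≈ε⇒x≈y)
  open import Relation.Binary.Reasoning.Setoid setoid

  private variable
    M N : ℕ

  lc : ∀ k → (Fin k → Carrier) → (Fin k → Vec F N) → Vec F N
  lc {N} = lincomb F N

  infix 4 _≋_
  _≋_ : Vec F N → Vec F N → Set ℓ
  _≋_ {N} = _≈ᵥ_ F N

  Span : ∀ k → (Fin k → Vec F N) → Vec F N → Set (c ⊔ ℓ)
  Span k bs v = Σ (Fin k → Carrier) λ cs → v ≋ lc k cs bs

  lincomb-sum : ∀ k cs (bs : Fin k → Vec F N) x → lc k cs bs x ≡ sum (λ r → cs r * bs r x)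
  lincomb-sum zero    cs bs x = ≡.refl
  lincomb-sum (suc k) cs bs x = ≡.cong (cs zero * bs zero x ⊕_) (lincomb-sum k (cs ∘ suc) (bs ∘ suc) x)

  lincomb-reindex : ∀ k cs (bs : Fin k → Vec F N) (f : Fin M → Fin N) x →
                    lc k cs bs (f x) ≡ lc k cs (λ r → bs r ∘ f) x
  lincomb-reindex zero    cs bs f x = ≡.refl
  lincomb-reindex (suc k) cs bs f x =
    ≡.cong (cs zero * bs zero (f x) ⊕_) (lincomb-reindex k (cs ∘ suc) (bs ∘ suc) f x)

  lincomb-congʳ : ∀ k cs {bs bs′ : Fin k → Vec F N} → (∀ r → bs r ≋ bs′ r) → lc k cs bs ≋ lc k cs bs′
  lincomb-congʳ zero    cs eq x = refl
  lincomb-congʳ (suc k) cs eq x = +-cong (*-congˡ (eq zero x)) (lincomb-congʳ k (cs ∘ suc) (eq ∘ suc) x)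

  lincomb-zeroʳ : ∀ k cs (bs : Fin k → Vec F N) x → (∀ r → bs r x ≈ 0#) → lc k cs bs x ≈ 0#
  lincomb-zeroʳ zero    cs bs x z = refl
  lincomb-zeroʳ (suc k) cs bs x z = begin
    cs zero * bs zero x ⊕ lc k (cs ∘ suc) (bs ∘ suc) x
      ≈⟨ +-cong (trans (*-congˡ (z zero)) (zeroʳ _)) (lincomb-zeroʳ k (cs ∘ suc) (bs ∘ suc) x (z ∘ suc)) ⟩
    0# ⊕ 0#   ≈⟨ +-identityˡ 0# ⟩
    0#        ∎

  lincomb-tail : ∀ k cs (bs : Fin (suc k) → Vec F N) → cs zero ≈ 0# →
                 lc (suc k) cs bs ≋ lc k (cs ∘ suc) (bs ∘ suc)
  lincomb-tail k cs bs z x =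
    trans (+-congʳ (trans (*-congʳ z) (zeroˡ _))) (+-identityˡ _)

  lincomb-+-* : ∀ k (u v : Fin k → Carrier) β (bs : Fin k → Vec F N) →
                lc k (λ r → u r ⊕ β * v r) bs ≋ λ x → lc k u bs x ⊕ β * lc k v bs x
  lincomb-+-* k u v β bs x = begin
    lc k (λ r → u r ⊕ β * v r) bs x                    ≡⟨ lincomb-sum k _ bs x ⟩
    sum (λ r → (u r ⊕ β * v r) * bs r x)
      ≈⟨ sum-cong-≋ (λ r → trans (distribʳ (bs r x) (u r) (β * v r)) (+-congˡ (*-assoc β (v r) (bs r x)))) ⟩
    sum (λ r → u r * bs r x ⊕ β * (v r * bs r x))      ≈⟨ ∑-distrib-+ (λ r → u r * bs r x) _ ⟩
    sum (λ r → u r * bs r x) ⊕ sum (λ r → β * (v r * bs r x))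
      ≈⟨ +-congˡ (sym (*-distribˡ-sum β (λ r → v r * bs r x))) ⟩
    sum (λ r → u r * bs r x) ⊕ β * sum (λ r → v r * bs r x)
      ≡⟨ ≡.sym (≡.cong₂ (λ s t → s ⊕ β * t) (lincomb-sum k u bs x) (lincomb-sum k v bs x)) ⟩
    lc k u bs x ⊕ β * lc k v bs x                       ∎

  lincomb-scaleʳ : ∀ k cs β (bs : Fin k → Vec F N) →
                   lc k cs (λ r → _·ᵥ_ F N β (bs r)) ≋ _·ᵥ_ F N β (lc k cs bs)
  lincomb-scaleʳ zero    cs β bs x = sym (zeroʳ β)
  lincomb-scaleʳ (suc k) cs β bs x = begin
    cs zero * (β * bs zero x) ⊕ lc k (cs ∘ suc) _ x
      ≈⟨ +-cong (trans (sym (*-assoc _ _ _)) (trans (*-congʳ (*-comm _ _)) (*-assoc _ _ _)))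
                (lincomb-scaleʳ k (cs ∘ suc) β (bs ∘ suc) x) ⟩
    β * (cs zero * bs zero x) ⊕ β * lc k (cs ∘ suc) (bs ∘ suc) x  ≈⟨ distribˡ β _ _ ⟨
    β * (cs zero * bs zero x ⊕ lc k (cs ∘ suc) (bs ∘ suc) x)      ∎

  lincomb-injective : ∀ k (bs : Fin k → Vec F N) → LinIndep F N k bs →
                      ∀ cs ds → lc k cs bs ≋ lc k ds bs → ∀ r → cs r ≈ ds r
  lincomb-injective k bs indep cs ds eq r =
    x∙y⁻¹≈ε⇒x≈y _ _ (trans (+-congˡ (sym (-1*x≈-x (ds r)))) (indep _ difference≈0 r))
    where
    difference≈0 : lc k (λ r → cs r ⊕ - 1# * ds r) bs ≋ 0ᵥ F _
    difference≈0 x = begin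
      lc k (λ r → cs r ⊕ - 1# * ds r) bs x   ≈⟨ lincomb-+-* k cs ds (- 1#) bs x ⟩
      lc k cs bs x ⊕ - 1# * lc k ds bs x     ≈⟨ +-cong (eq x) (-1*x≈-x _) ⟩
      lc k ds bs x ⊕ - lc k ds bs x          ≈⟨ -‿inverseʳ _ ⟩
      0#                                     ∎

  lincomb-assoc : ∀ k a e (ρ : Fin k → Vec F a) (α : Fin a → Vec F N) →
                  lc k e (λ r → lc a (ρ r) α) ≋ lc a (lc k e ρ) α
  lincomb-assoc k a e ρ α x = begin
    lc k e (λ r → lc a (ρ r) α) x                   ≡⟨ lincomb-sum k e _ x ⟩
    sum (λ r → e r * lc a (ρ r) α x)
      ≡⟨ sum-cong-≗ (λ r → ≡.cong (e r *_) (lincomb-sum a (ρ r) α x)) ⟩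
    sum (λ r → e r * sum (λ l → ρ r l * α l x))
      ≈⟨ sum-cong-≋ (λ r → *-distribˡ-sum (e r) (λ l → ρ r l * α l x)) ⟩
    sum (λ r → sum (λ l → e r * (ρ r l * α l x)))  ≈⟨ ∑-comm (λ r l → e r * (ρ r l * α l x)) ⟩
    sum (λ l → sum (λ r → e r * (ρ r l * α l x)))
      ≈⟨ sum-cong-≋ (λ l → sum-cong-≋ (λ r → sym (*-assoc (e r) (ρ r l) (α l x)))) ⟩
    sum (λ l → sum (λ r → e r * ρ r l * α l x))
      ≈⟨ sum-cong-≋ (λ l → sym (*-distribʳ-sum (α l x) (λ r → e r * ρ r l))) ⟩
    sum (λ l → sum (λ r → e r * ρ r l) * α l x)
      ≡⟨ sum-cong-≗ (λ l → ≡.cong (_* α l x) (≡.sym (lincomb-sum k e ρ l))) ⟩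
    sum (λ l → lc k e ρ l * α l x)                  ≡⟨ lincomb-sum a _ α x ⟨
    lc a (lc k e ρ) α x                             ∎

  lincomb-++ : ∀ a {b} cs (u : Fin a → Vec F N) (v : Fin b → Vec F N) →
               lc (a + b) cs (u ++ v) ≋ λ x → lc a (cs ∘ (_↑ˡ b)) u x ⊕ lc b (cs ∘ (a ↑ʳ_)) v x
  lincomb-++ zero    cs u v x = sym (+-identityˡ _)
  lincomb-++ (suc a) cs u v x = begin
    cs zero * u zero x ⊕ lc (a + _) (cs ∘ suc) ((u ++ v) ∘ suc) x
      ≈⟨ +-congˡ (lincomb-congʳ (a + _) (cs ∘ suc) (λ r y → reflexive (≡.cong-app (++-suc u v r) y)) x) ⟩
    cs zero * u zero x ⊕ lc (a + _) (cs ∘ suc) ((u ∘ suc) ++ v) x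
      ≈⟨ +-congˡ (lincomb-++ a (cs ∘ suc) (u ∘ suc) v x) ⟩
    cs zero * u zero x ⊕ (lc a (cs ∘ suc ∘ (_↑ˡ _)) (u ∘ suc) x ⊕ lc _ (cs ∘ (suc a ↑ʳ_)) v x)
      ≈⟨ +-assoc _ _ _ ⟨
    lc (suc a) (cs ∘ (_↑ˡ _)) u x ⊕ lc _ (cs ∘ (suc a ↑ʳ_)) v x ∎

  standardBasis : ∀ m → Fin m → Vec F m
  standardBasis (suc m) zero    zero    = 1#
  standardBasis (suc m) zero    (suc x) = 0#
  standardBasis (suc m) (suc l) zero    = 0#
  standardBasis (suc m) (suc l) (suc x) = standardBasis m l x

  lincomb-standardBasis : ∀ m cs → lc m cs (standardBasis m) ≋ cs
  lincomb-standardBasis (suc m) cs zero = begin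
    cs zero * 1# ⊕ lc m (cs ∘ suc) (standardBasis (suc m) ∘ suc) zero
      ≈⟨ +-cong (*-identityʳ _) (lincomb-zeroʳ m (cs ∘ suc) _ zero (λ _ → refl)) ⟩
    cs zero ⊕ 0#  ≈⟨ +-identityʳ _ ⟩
    cs zero       ∎
  lincomb-standardBasis (suc m) cs (suc x) = begin
    cs zero * 0# ⊕ lc m (cs ∘ suc) (standardBasis (suc m) ∘ suc) (suc x)
      ≡⟨ ≡.cong (cs zero * 0# ⊕_) (lincomb-reindex m (cs ∘ suc) _ suc x) ⟩
    cs zero * 0# ⊕ lc m (cs ∘ suc) (standardBasis m) x
      ≈⟨ +-cong (zeroʳ _) (lincomb-standardBasis m (cs ∘ suc) x) ⟩
    0# ⊕ cs (suc x)  ≈⟨ +-identityˡ _ ⟩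
    cs (suc x)       ∎

  lincomb-↑ˡ : ∀ k cs (u : Fin k → Vec F M) (v : Fin k → Vec F N) l →
               lc k cs (λ r → u r ++ v r) (l ↑ˡ N) ≈ lc k cs u l
  lincomb-↑ˡ k cs u v l = trans (reflexive (lincomb-reindex k cs _ (_↑ˡ _) l))
    (lincomb-congʳ k cs (λ r x → reflexive (lookup-++ˡ (u r) (v r) x)) l)

  lincomb-↑ʳ : ∀ k cs (u : Fin k → Vec F M) (v : Fin k → Vec F N) l →
               lc k cs (λ r → u r ++ v r) (M ↑ʳ l) ≈ lc k cs v l
  lincomb-↑ʳ k cs u v l = trans (reflexive (lincomb-reindex k cs _ (_ ↑ʳ_) l))
    (lincomb-congʳ k cs (λ r x → reflexive (lookup-++ʳ (u r) (v r) x)) l)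

  module _ {p : Level} (U : Subspace F N p) where
    open Subspace U

    lincomb-∈ : ∀ k cs (bs : Fin k → Vec F N) → (∀ r → pred (bs r)) → pred (lc k cs bs)
    lincomb-∈ zero    cs bs bs∈ = 0∈
    lincomb-∈ (suc k) cs bs bs∈ =
      +∈ (·∈ (cs zero) (bs∈ zero)) (lincomb-∈ k (cs ∘ suc) (bs ∘ suc) (bs∈ ∘ suc))

    module _ (T : LinMap F N U) where
      open LinMap T renaming (cong to fun-cong)

      fun-0ᵥ : fun (0ᵥ F N) ≋ 0ᵥ F N
      fun-0ᵥ x = begin
        fun (0ᵥ F N) x           ≈⟨ fun-cong 0∈ (·∈ 0# 0∈) (λ _ → sym (zeroˡ 0#)) x ⟩
        fun (_·ᵥ_ F N 0# _) x    ≈⟨ hom 0# 0∈ x ⟩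
        0# * fun (0ᵥ F N) x      ≈⟨ zeroˡ _ ⟩
        0#                       ∎

      fun-lincomb : ∀ k cs (bs : Fin k → Vec F N) → (∀ r → pred (bs r)) →
                    fun (lc k cs bs) ≋ lc k cs (fun ∘ bs)
      fun-lincomb zero    cs bs bs∈ = fun-0ᵥ
      fun-lincomb (suc k) cs bs bs∈ x = begin
        fun (lc (suc k) cs bs) x
          ≈⟨ add (·∈ (cs zero) (bs∈ zero)) (lincomb-∈ k (cs ∘ suc) (bs ∘ suc) (bs∈ ∘ suc)) x ⟩
        fun (_·ᵥ_ F N (cs zero) (bs zero)) x ⊕ fun (lc k (cs ∘ suc) (bs ∘ suc)) x
          ≈⟨ +-cong (hom (cs zero) (bs∈ zero) x) (fun-lincomb k (cs ∘ suc) (bs ∘ suc) (bs∈ ∘ suc) x) ⟩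
        lc (suc k) cs (fun ∘ bs) x ∎

module RankNullity {c ℓ : Level} (F : FiniteField c ℓ) where
  open FiniteField F hiding (zero) renaming (_+_ to _⊕_)
  open LinearCombination F
  open import Algebra.Properties.Semiring.Sum semiring
    using (sum; sum-remove; sum-cong-≋; sum-cong-≗; ∑-distrib-+; *-distribʳ-sum)
  open import Algebra.Properties.Ring ring using (-‿distribˡ-*)
  open import Relation.Binary.Reasoning.Setoid setoid

  private variable
    N : ℕ

  RelationsSpannedBy : ∀ {m} k → (Fin k → Vec F m) → (Fin m → Vec F N) → Set (c ⊔ ℓ)
  RelationsSpannedBy {N} {m} k ks g = ∀ cs → lc m cs g ≋ 0ᵥ F N → Span k ks cs

  SpanningBound : ℕ → Set (c ⊔ ℓ)
  SpanningBound k = ∀ m (ks : Fin k → Vec F m) → (∀ cs → Span k ks cs) → m ≤ k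

  eliminate-pivot : ∀ k b m (g : Fin (suc m) → Vec F N) (w : Fin (suc b) → Vec F N)
    (C : Fin (suc m) → Fin (suc b) → Carrier) → (∀ l → g l ≋ lc (suc b) (C l) w)
    → (i : Fin (suc m)) → ¬ (C i zero ≈ 0#)
    → (ks : Fin k → Vec F (suc m)) → RelationsSpannedBy k ks g
    → Σ (Fin m → Vec F N) λ g′ →
        (∀ l → Span b (w ∘ suc) (g′ l)) × RelationsSpannedBy k (λ r → ks r ∘ punchIn i) g′
  eliminate-pivot {N} k b m g w C g≈ i Ci0≉0 ks rel = g′ , g′-span , g′-rel
    where
    pᵢ = C i zero
    pᵢ⁻¹ = proj₁ (inverse pᵢ Ci0≉0)

    μ : Fin m → Carrier
    μ l = - (C (punchIn i l) zero * pᵢ⁻¹)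

    g′ : Fin m → Vec F N
    g′ l x = g (punchIn i l) x ⊕ μ l * g i x

    μ-cancels : ∀ l → C (punchIn i l) zero ⊕ μ l * pᵢ ≈ 0#
    μ-cancels l = begin
      Cₗ ⊕ μ l * pᵢ              ≈⟨ +-congˡ (-‿distribˡ-* _ _) ⟨
      Cₗ ⊕ - (Cₗ * pᵢ⁻¹ * pᵢ)     ≈⟨ +-congˡ (-‿cong (*-assoc _ _ _)) ⟩
      Cₗ ⊕ - (Cₗ * (pᵢ⁻¹ * pᵢ))
        ≈⟨ +-congˡ (-‿cong (*-congˡ (trans (*-comm _ _) (proj₂ (inverse pᵢ Ci0≉0))))) ⟩
      Cₗ ⊕ - (Cₗ * 1#)            ≈⟨ +-congˡ (-‿cong (*-identityʳ _)) ⟩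
      Cₗ ⊕ - Cₗ                   ≈⟨ -‿inverseʳ _ ⟩
      0#                          ∎
      where Cₗ = C (punchIn i l) zero

    g′-span : ∀ l → Span b (w ∘ suc) (g′ l)
    g′-span l = (C′ ∘ suc) , λ x → begin
      g′ l x
        ≈⟨ +-cong (g≈ (punchIn i l) x) (*-congˡ (g≈ i x)) ⟩
      lc _ (C (punchIn i l)) w x ⊕ μ l * lc _ (C i) w x
        ≈⟨ lincomb-+-* _ (C (punchIn i l)) (C i) (μ l) w x ⟨
      lc (suc b) C′ w x            ≈⟨ lincomb-tail b C′ w (μ-cancels l) x ⟩
      lc b (C′ ∘ suc) (w ∘ suc) x  ∎
      where
      C′ : Fin (suc b) → Carrier
      C′ j = C (punchIn i l) j ⊕ μ l * C i j

    -- A relation cs′ of g′ is the restriction of the relation of g that puts t at position i.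
    g′-rel : RelationsSpannedBy k (λ r → ks r ∘ punchIn i) g′
    g′-rel cs′ cs′-rel = ds , λ l → begin
      cs′ l                                  ≡⟨ insertAt-punchIn cs′ i t l ⟨
      cs (punchIn i l)                       ≈⟨ cs≈ (punchIn i l) ⟩
      lc k ds ks (punchIn i l)               ≡⟨ lincomb-reindex k ds ks (punchIn i) l ⟩
      lc k ds (λ r → ks r ∘ punchIn i) l     ∎
      where
      t = sum (λ l → cs′ l * μ l)
      cs = insertAt cs′ i t

      rest : Vec F N
      rest x = sum (λ l → cs′ l * g (punchIn i l) x)

      lincomb-g′ : ∀ x → lc m cs′ g′ x ≈ rest x ⊕ t * g i x
      lincomb-g′ x = begin
        lc m cs′ g′ x                                                ≡⟨ lincomb-sum m cs′ g′ x ⟩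
        sum (λ l → cs′ l * (g (punchIn i l) x ⊕ μ l * g i x))
          ≈⟨ sum-cong-≋ {m} (λ l → trans (distribˡ _ _ _) (+-congˡ (sym (*-assoc _ _ _)))) ⟩
        sum (λ l → cs′ l * g (punchIn i l) x ⊕ cs′ l * μ l * g i x)
          ≈⟨ ∑-distrib-+ _ (λ l → cs′ l * μ l * g i x) ⟩
        rest x ⊕ sum (λ l → cs′ l * μ l * g i x)
          ≈⟨ +-congˡ (*-distribʳ-sum (g i x) (λ l → cs′ l * μ l)) ⟨
        rest x ⊕ t * g i x                                           ∎

      cs-rel : lc (suc m) cs g ≋ 0ᵥ F N
      cs-rel x = begin
        lc (suc m) cs g x                ≡⟨ lincomb-sum (suc m) cs g x ⟩
        sum (λ r → cs r * g r x)         ≈⟨ sum-remove (λ r → cs r * g r x) ⟩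
        cs i * g i x ⊕ sum (λ l → cs (punchIn i l) * g (punchIn i l) x)
          ≡⟨ ≡.cong₂ (λ s u → s * g i x ⊕ u) (insertAt-lookup cs′ i t)
                     (sum-cong-≗ (λ l → ≡.cong (_* g (punchIn i l) x) (insertAt-punchIn cs′ i t l))) ⟩
        t * g i x ⊕ rest x               ≈⟨ +-comm _ _ ⟩
        rest x ⊕ t * g i x               ≈⟨ lincomb-g′ x ⟨
        lc m cs′ g′ x                    ≈⟨ cs′-rel x ⟩
        0#                               ∎

      ds = proj₁ (rel cs cs-rel)
      cs≈ = proj₂ (rel cs cs-rel)

  rank-nullity-from : ∀ {k} → SpanningBound k →
    ∀ b m (g : Fin m → Vec F N) (w : Fin b → Vec F N) → (∀ l → Span b w (g l)) →
    (ks : Fin k → Vec F m) → RelationsSpannedBy k ks g → m ≤ k + b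
  rank-nullity-from {k = k} bound zero m g w g∈span ks rel =
    ℕ.≤-trans (bound m ks every-cs-is-relation) (ℕ.m≤m+n k 0)
    where
    every-cs-is-relation : ∀ cs → Span k ks cs
    every-cs-is-relation cs = rel cs λ x → lincomb-zeroʳ m cs g x (λ l → proj₂ (g∈span l) x)
  rank-nullity-from bound (suc b) zero g w g∈span ks rel = z≤n
  rank-nullity-from {k = k} bound (suc b) (suc m) g w g∈span ks rel
    with Fin.any? (λ l → ¬? (proj₁ (g∈span l) zero ≟ 0#))
  ... | yes (i , Ci0≉0) =
    let g′ , g′-span , g′-rel =
          eliminate-pivot k b m g w (proj₁ ∘ g∈span) (proj₂ ∘ g∈span) i Ci0≉0 ks rel
    in ℕ.≤-trans (s≤s (rank-nullity-from bound b m g′ (w ∘ suc) g′-span _ g′-rel))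
                 (ℕ.≤-reflexive (≡.sym (ℕ.+-suc k b)))
  ... | no no-pivot =
    ℕ.≤-trans (rank-nullity-from bound b (suc m) g (w ∘ suc) g∈tail ks rel)
              (ℕ.+-monoʳ-≤ k (ℕ.n≤1+n b))
    where
    C = proj₁ ∘ g∈span
    g∈tail : ∀ l → Span b (w ∘ suc) (g l)
    g∈tail l = C l ∘ suc , λ x → trans (proj₂ (g∈span l) x)
      (lincomb-tail b (C l) w (decidable-stable (C l zero ≟ 0#) (no-pivot ∘ (l ,_))) x)

  spanning-bound-0 : SpanningBound 0
  spanning-bound-0 zero    ks spans = z≤n
  spanning-bound-0 (suc m) ks spans = ⊥-elim (0≉1 (sym (proj₂ (spans (λ _ → 1#)) zero)))

  -- The standard basis of F^m has no nontrivial relations and lies in the span of ks.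
  spanning-bound : ∀ k → SpanningBound k
  spanning-bound k m ks spans =
    rank-nullity-from spanning-bound-0 k m (standardBasis m) ks (spans ∘ standardBasis m) (λ ())
      (λ cs cs-rel → (λ ()) , λ x → trans (sym (lincomb-standardBasis m cs x)) (cs-rel x))

  rank-nullity : ∀ k b m (g : Fin m → Vec F N) (w : Fin b → Vec F N) → (∀ l → Span b w (g l)) →
                 (ks : Fin k → Vec F m) → RelationsSpannedBy k ks g → m ≤ k + b
  rank-nullity k = rank-nullity-from (spanning-bound k)

module Filtration {c ℓ p : Level} (F : FiniteField c ℓ) (n : ℕ) (W : Subspace F n p) (T : LinMap F n W) where
  open FiniteField F hiding (zero) renaming (_+_ to _⊕_)
  open LinearCombination F
  open RankNullity F using (RelationsSpannedBy; rank-nullity)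
  open import Algebra.Properties.Ring ring using (-1*x≈-x; +-inverseˡ-unique; +-inverseʳ-unique)
  open import Relation.Binary.Reasoning.Setoid setoid
  open LinMap T renaming (cong to fun-cong)

  𝕎 : ℕ → Vec F n → Set p
  𝕎 = Wseq F n W T

  𝕎-⊆W : ∀ i {v} → 𝕎 (suc i) v → Subspace.pred W v
  𝕎-⊆W zero    v∈ = v∈
  𝕎-⊆W (suc i) v∈ = 𝕎-⊆W i (proj₁ v∈)

  𝕎-antitone : ∀ i {v} → 𝕎 (suc i) v → 𝕎 i v
  𝕎-antitone zero    v∈ = _
  𝕎-antitone (suc i) v∈ = proj₁ v∈

  𝕎-fun : ∀ i {v} → 𝕎 (suc i) v → 𝕎 i (fun v)
  𝕎-fun zero    v∈ = _
  𝕎-fun (suc i) v∈ = proj₂ v∈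

  𝕎-subspace : ℕ → Subspace F n p
  Subspace.pred (𝕎-subspace i) = 𝕎 i
  Subspace.resp (𝕎-subspace zero)          _ _ = _
  Subspace.resp (𝕎-subspace (suc zero))    = Subspace.resp W
  Subspace.resp (𝕎-subspace (suc (suc i))) u≋v (u∈ , fun-u∈) =
    resp u≋v u∈ , resp (fun-cong (𝕎-⊆W i u∈) (𝕎-⊆W i (resp u≋v u∈)) u≋v) fun-u∈
    where open Subspace (𝕎-subspace (suc i))
  Subspace.0∈ (𝕎-subspace zero)          = _
  Subspace.0∈ (𝕎-subspace (suc zero))    = Subspace.0∈ W
  Subspace.0∈ (𝕎-subspace (suc (suc i))) = 0∈ , resp (λ x → sym (fun-0ᵥ W T x)) 0∈
    where open Subspace (𝕎-subspace (suc i))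
  Subspace.+∈ (𝕎-subspace zero)          _ _ = _
  Subspace.+∈ (𝕎-subspace (suc zero))    = Subspace.+∈ W
  Subspace.+∈ (𝕎-subspace (suc (suc i))) (u∈ , fun-u∈) (v∈ , fun-v∈) =
    +∈ u∈ v∈ , resp (λ x → sym (add (𝕎-⊆W i u∈) (𝕎-⊆W i v∈) x)) (+∈ fun-u∈ fun-v∈)
    where open Subspace (𝕎-subspace (suc i))
  Subspace.·∈ (𝕎-subspace zero)          _ _ = _
  Subspace.·∈ (𝕎-subspace (suc zero))    = Subspace.·∈ W
  Subspace.·∈ (𝕎-subspace (suc (suc i))) a (v∈ , fun-v∈) =
    ·∈ a v∈ , resp (λ x → sym (hom a (𝕎-⊆W i v∈) x)) (·∈ a fun-v∈)
    where open Subspace (𝕎-subspace (suc i))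

  𝕎-dim-convex : ∀ j {a b k} → HasDim F n (𝕎 j) b → HasDim F n (𝕎 (suc j)) a →
                 HasDim F n (𝕎 (suc (suc j))) k → a + a ≤ k + b
  𝕎-dim-convex j {a} {b} {k}
    (β , _ , _ , β-spans) (α , α∈ , α-indep , α-spans) (κ , κ∈ , _ , κ-spans) =
    rank-nullity k b (a + a) ((fun ∘ α) ++ α) β g∈span ks relations
    where
    open Subspace (𝕎-subspace (suc j)) using (resp; ·∈)

    g∈span : ∀ z → Span b β (((fun ∘ α) ++ α) z)
    g∈span = ++⁺ (Span b β) (λ l → β-spans _ (𝕎-fun j (α∈ l)))
                            (λ l → β-spans _ (𝕎-antitone j (α∈ l)))

    α∈W : ∀ l → Subspace.pred W (α l)
    α∈W = 𝕎-⊆W j ∘ α∈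

    -Tκ : Fin k → Vec F n
    -Tκ r = _·ᵥ_ F n (- 1#) (fun (κ r))

    κ-coords = λ r → α-spans (κ r) (𝕎-antitone (suc j) (κ∈ r))
    -Tκ-coords = λ r → α-spans (-Tκ r) (·∈ (- 1#) (𝕎-fun (suc j) (κ∈ r)))

    ks : Fin k → Vec F (a + a)
    ks r = proj₁ (κ-coords r) ++ proj₁ (-Tκ-coords r)

    relations : RelationsSpannedBy k ks ((fun ∘ α) ++ α)
    relations cs cs-rel = e , ↑-split a _ xs≈ ys≈
      where
      xs = cs ∘ (_↑ˡ a)
      ys = cs ∘ (a ↑ʳ_)
      x₀ = lc a xs α
      y₀ = lc a ys α

      Tx₀+y₀≈0 : ∀ x → fun x₀ x ⊕ y₀ x ≈ 0#
      Tx₀+y₀≈0 x = trans (+-congʳ (fun-lincomb W T a xs α α∈W x))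
                         (trans (sym (lincomb-++ a cs (fun ∘ α) α x)) (cs-rel x))

      x₀∈ : 𝕎 (suc (suc j)) x₀
      x₀∈ = lincomb-∈ (𝕎-subspace (suc j)) a xs α α∈
          , resp (λ x → trans (-1*x≈-x _) (sym (+-inverseˡ-unique _ _ (Tx₀+y₀≈0 x))))
                 (·∈ (- 1#) (lincomb-∈ (𝕎-subspace (suc j)) a ys α α∈))

      e = proj₁ (κ-spans x₀ x₀∈)
      x₀≈ = proj₂ (κ-spans x₀ x₀∈)

      xs≈ : ∀ l → cs (l ↑ˡ a) ≈ lc k e ks (l ↑ˡ a)
      xs≈ l = trans (lincomb-injective a α α-indep xs _ x₀-coords l) (sym (lincomb-↑ˡ k e _ _ l))
        where
        x₀-coords : x₀ ≋ lc a (lc k e (proj₁ ∘ κ-coords)) α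
        x₀-coords x = begin
          x₀ x                                               ≈⟨ x₀≈ x ⟩
          lc k e κ x                                         ≈⟨ lincomb-congʳ k e (proj₂ ∘ κ-coords) x ⟩
          lc k e (λ r → lc a (proj₁ (κ-coords r)) α) x       ≈⟨ lincomb-assoc k a e _ α x ⟩
          lc a (lc k e (proj₁ ∘ κ-coords)) α x               ∎

      ys≈ : ∀ l → cs (a ↑ʳ l) ≈ lc k e ks (a ↑ʳ l)
      ys≈ l = trans (lincomb-injective a α α-indep ys _ y₀-coords l) (sym (lincomb-↑ʳ k e _ _ l))
        where
        κ∈W = λ r → 𝕎-⊆W j (𝕎-antitone (suc j) (κ∈ r))
        y₀-coords : y₀ ≋ lc a (lc k e (proj₁ ∘ -Tκ-coords)) α
        y₀-coords x = begin
          y₀ x                                 ≈⟨ +-inverseʳ-unique _ _ (Tx₀+y₀≈0 x) ⟩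
          - fun x₀ x
            ≈⟨ -‿cong (fun-cong (𝕎-⊆W j (proj₁ x₀∈)) (lincomb-∈ W k e κ κ∈W) x₀≈ x) ⟩
          - fun (lc k e κ) x                   ≈⟨ -‿cong (fun-lincomb W T k e κ κ∈W x) ⟩
          - lc k e (fun ∘ κ) x                 ≈⟨ -1*x≈-x _ ⟨
          - 1# * lc k e (fun ∘ κ) x            ≈⟨ lincomb-scaleʳ k e (- 1#) (fun ∘ κ) x ⟨
          lc k e -Tκ x                         ≈⟨ lincomb-congʳ k e (proj₂ ∘ -Tκ-coords) x ⟩
          lc k e (λ r → lc a (proj₁ (-Tκ-coords r)) α) x  ≈⟨ lincomb-assoc k a e _ α x ⟩
          lc a (lc k e (proj₁ ∘ -Tκ-coords)) α x          ∎

m+m≤n+o⇒m∸n≤o∸m : ∀ m n o → m + m ≤ n + o → m ∸ n ≤ o ∸ m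
m+m≤n+o⇒m∸n≤o∸m m n o m+m≤n+o = begin
  m ∸ n              ≤⟨ ℕ.∸-monoˡ-≤ n (ℕ.m+n≤o⇒m≤o∸n m m+m≤n+o) ⟩
  n + o ∸ m ∸ n      ≡⟨ ℕ.∸-+-assoc (n + o) m n ⟩
  n + o ∸ (m + n)    ≡⟨ ≡.cong (n + o ∸_) (ℕ.+-comm m n) ⟩
  n + o ∸ (n + m)    ≡⟨ ℕ.[m+n]∸[m+o]≡n∸o n o m ⟩
  o ∸ m              ∎
  where open ℕ.≤-Reasoning

mainTheorem1 : {c ℓ p : Level} (F : FiniteField c ℓ) (n : ℕ)
    (W : Subspace F n p) (T : LinMap F n W)
    (d : ℕ → ℕ) → (∀ i → HasDim F n (Wseq F n W T i) (d i))
    → (L : ℕ) → IsLength F n W T L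
    → ∀ j → 1 ≤ j → j + 1 ≤ L
    → d j ∸ d (suc j) ≤ d (j ∸ 1) ∸ d j
-- The bound holds for every j ≥ 1; the length ℓ(T) only delimits the range of j.
mainTheorem1 F n W T d dims _ _ (suc j) _ _ =
  m+m≤n+o⇒m∸n≤o∸m (d (suc j)) (d (suc (suc j))) (d j)
    (𝕎-dim-convex j (dims j) (dims (suc j)) (dims (suc (suc j))))
  where open Filtration F n W T
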